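{- Let $N$ and $n$ be positive integers. Let $G$ be the complete graph on a set $A$ of at least $nN$ vertices and let $(A_i)_{i=1}^{n}$ be a partition of $A$ (pairwise disjoint sets with union $A$) with $|A_i|\ge N$ for every $i\in[n]$. Then for any colouring of the edges of $G$ with the colours red and blue, either there is a red path $u_1u_2\cdots u_n$ with $u_i\in A_i$ for each $i\in[n]$, or for some $i\in[n-1]$ there exist sets $B_i\subseteq A_i$ and $B_{i+1}\subseteq A_{i+1}$ with $\min\{|B_i|,|B_{i+1}|\}\ge N/2$ such that every edge between $B_i$ and $B_{i+1}$ is blue.
   Context: $[k]$ denotes $\{1,\dots,k\}$. A red path $u_1\cdots u_n$ means that every edge $\{u_j,u_{j+1}\}$, $j\in[n-1]$, is red. -}

module Defs where

open import Data.Nat using (ℕ)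
open import Data.Fin using (Fin; _≟_)
open import Data.Fin.Subset using (Subset)
open import Data.Vec using (tabulate)
open import Relation.Nullary.Decidable using (⌊_⌋)

data Colour : Set where
  red blue : Colour

cell : {m n : ℕ} → (Fin m → Fin n) → Fin n → Subset m
cell part i = tabulate (λ v → ⌊ part v ≟ i ⌋)

-- Let A₀, …, A_{n-1} be the parts and R_k ⊆ A_k the vertices reached from A₀ by a red path
-- visiting A₀, …, A_k in order.  If R_{n-1} is nonempty we have the red path.  Otherwise
-- |R₀| = |A₀| ≥ N while R_{n-1} = ∅, so some k has |R_k| ≥ N/2 > |R_{k+1}|.  Every edge from
-- R_k to A_{k+1} ∖ R_{k+1} is blue, and |A_{k+1} ∖ R_{k+1}| = |A_{k+1}| - |R_{k+1}| ≥ N/2.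
module Submission where

open import Defs
open import Data.Nat using (ℕ; _*_; _≤_; _<_; suc)
open import Data.Fin using (Fin; toℕ)
open import Data.Fin.Subset using (Subset; _∈_; ∣_∣)
open import Data.Product using (Σ; _×_; ∃-syntax)
open import Data.Sum using (_⊎_)
open import Relation.Binary.PropositionalEquality using (_≡_)

open import Data.Nat using (zero; _+_; z≤n; s≤s; _≤?_)
import Data.Nat as ℕ
import Data.Nat.Properties as ℕ
open import Data.Fin using (inject₁; fromℕ<)
import Data.Fin as Fin
open import Data.Fin.Properties using (any?; toℕ-injective; toℕ≤pred[n]; toℕ-inject₁; toℕ-fromℕ<)
open import Data.Fin.Subset using (_∩_; ∁; inside; outside; Nonempty)
open import Data.Fin.Subset.Properties using (_∈?_; x∈p∩q⁻; x∈∁p⇒x∉p;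
  nonempty?; Empty-unique; ∣⊥∣≡0)
open import Data.Product using (_,_; proj₁)
open import Data.Sum using (inj₁; inj₂)
open import Data.Bool using (true)
open import Data.Vec using (_∷_; []; tabulate)
open import Data.Vec.Properties using (lookup∘tabulate; lookup⇒[]=; []=⇒lookup; tabulate-cong)
open import Function using (_∘_; mk⇔)
open import Relation.Binary.Definitions using (DecidableEquality)
open import Relation.Binary.PropositionalEquality using (refl; sym; trans; cong; subst)
open import Relation.Nullary using (Dec; yes; no; ¬_; does; contradiction)
open import Relation.Nullary.Decidable using (_×-dec_; dec-true; does-⇔; isYes≗does)
open import Relation.Unary using (Pred; Decidable)

toSubset : ∀ {m ℓ} {P : Pred (Fin m) ℓ} → Decidable P → Subset m
toSubset P? = tabulate (does ∘ P?)

does≡true⇒ : ∀ {ℓ} {A : Set ℓ} (a? : Dec A) → does a? ≡ true → A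
does≡true⇒ (yes a) _ = a

module _ {m ℓ} {P : Pred (Fin m) ℓ} (P? : Decidable P) {v : Fin m} where

  ∈-toSubset⁺ : P v → v ∈ toSubset P?
  ∈-toSubset⁺ p = lookup⇒[]= v _ (trans (lookup∘tabulate _ v) (dec-true (P? v) p))

  ∈-toSubset⁻ : v ∈ toSubset P? → P v
  ∈-toSubset⁻ v∈ = does≡true⇒ (P? v) (trans (sym (lookup∘tabulate _ v)) ([]=⇒lookup v∈))

∣p∩q∣+∣p∩∁q∣≡∣p∣ : ∀ {m} (p q : Subset m) → ∣ p ∩ q ∣ + ∣ p ∩ ∁ q ∣ ≡ ∣ p ∣
∣p∩q∣+∣p∩∁q∣≡∣p∣ []            []            = refl
∣p∩q∣+∣p∩∁q∣≡∣p∣ (inside  ∷ p) (inside  ∷ q) = cong suc (∣p∩q∣+∣p∩∁q∣≡∣p∣ p q)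
∣p∩q∣+∣p∩∁q∣≡∣p∣ (inside  ∷ p) (outside ∷ q) =
  trans (ℕ.+-suc _ _) (cong suc (∣p∩q∣+∣p∩∁q∣≡∣p∣ p q))
∣p∩q∣+∣p∩∁q∣≡∣p∣ (outside ∷ p) (inside  ∷ q) = ∣p∩q∣+∣p∩∁q∣≡∣p∣ p q
∣p∩q∣+∣p∩∁q∣≡∣p∣ (outside ∷ p) (outside ∷ q) = ∣p∩q∣+∣p∩∁q∣≡∣p∣ p q

downcrossing : ∀ {N} (f : ℕ → ℕ) K → N ≤ f 0 → f K < N →
               ∃[ k ] k < K × N ≤ f k × f (suc k) < N
downcrossing f zero    N≤f₀ f₀<N = contradiction N≤f₀ (ℕ.<⇒≱ f₀<N)
downcrossing {N} f (suc K) N≤f₀ fK+1<N with N ≤? f K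
... | yes N≤fK = K , ℕ.n<1+n K , N≤fK , fK+1<N
... | no  N≰fK with downcrossing f K N≤f₀ (ℕ.≰⇒> N≰fK)
...   | k , k<K , rest = k , ℕ.m<n⇒m<1+n k<K , rest

half-of-rest : ∀ {N a b} → N ≤ b + a → 2 * b < N → N ≤ 2 * a
half-of-rest {N} {a} {b} N≤b+a 2b<N = ℕ.+-cancelˡ-≤ (2 * b) N (2 * a) (begin
  2 * b + N       ≤⟨ ℕ.+-monoˡ-≤ N (ℕ.<⇒≤ 2b<N) ⟩
  N + N           ≡⟨ cong (N +_) (sym (ℕ.+-identityʳ N)) ⟩
  2 * N           ≤⟨ ℕ.*-monoʳ-≤ 2 N≤b+a ⟩
  2 * (b + a)     ≡⟨ ℕ.*-distribˡ-+ 2 b a ⟩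
  2 * b + 2 * a   ∎)
  where open ℕ.≤-Reasoning

_≟ᶜ_ : DecidableEquality Colour
red  ≟ᶜ red  = yes refl
red  ≟ᶜ blue = no λ ()
blue ≟ᶜ red  = no λ ()
blue ≟ᶜ blue = yes refl

≢red⇒≡blue : ∀ {x} → ¬ x ≡ red → x ≡ blue
≢red⇒≡blue {red}  x≢red = contradiction refl x≢red
≢red⇒≡blue {blue} _     = refl

module RedLayers {m : ℕ} (c : Fin m → Fin m → Colour) (A : ℕ → Subset m) where

  redNeighbour? : (S : Subset m) → Decidable (λ v → ∃[ u ] u ∈ S × c u v ≡ red)
  redNeighbour? S v = any? (λ u → u ∈? S ×-dec c u v ≟ᶜ red)

  redNeighbours : Subset m → Subset m
  redNeighbours S = toSubset (redNeighbour? S)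

  reached : ℕ → Subset m
  reached zero    = A zero
  reached (suc k) = A (suc k) ∩ redNeighbours (reached k)

  unreached : ℕ → Subset m
  unreached k = A (suc k) ∩ ∁ (redNeighbours (reached k))

  reached⊆A : ∀ k {v} → v ∈ reached k → v ∈ A k
  reached⊆A zero    v∈ = v∈
  reached⊆A (suc k) v∈ = proj₁ (x∈p∩q⁻ _ _ v∈)

  unreached⊆A : ∀ k {v} → v ∈ unreached k → v ∈ A (suc k)
  unreached⊆A k v∈ = proj₁ (x∈p∩q⁻ _ _ v∈)

  ∣reached∣+∣unreached∣≡∣A∣ : ∀ k → ∣ reached (suc k) ∣ + ∣ unreached k ∣ ≡ ∣ A (suc k) ∣
  ∣reached∣+∣unreached∣≡∣A∣ k = ∣p∩q∣+∣p∩∁q∣≡∣p∣ (A (suc k)) _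

  reached→unreached-blue : ∀ k {u v} → u ∈ reached k → v ∈ unreached k → c u v ≡ blue
  reached→unreached-blue k {u} u∈ v∈ with x∈p∩q⁻ _ _ v∈
  ... | _ , v∉ = ≢red⇒≡blue λ red-uv →
    x∈∁p⇒x∉p v∉ (∈-toSubset⁺ (redNeighbour? _) (u , u∈ , red-uv))

  record RedWalk (k : ℕ) (v : Fin m) : Set where
    field
      vertex    : ℕ → Fin m
      ends-at   : vertex k ≡ v
      visits    : ∀ {j} → j ≤ k → vertex j ∈ A j
      red-steps : ∀ {j} → j < k → c (vertex j) (vertex (suc j)) ≡ red

  extend : ∀ {k u v} → RedWalk k u → c u v ≡ red → v ∈ A (suc k) → RedWalk (suc k) v
  extend {k} {u} {v} w red-uv v∈ = record
    { vertex = vertex′ ; ends-at = ends-at′ ; visits = visits′ ; red-steps = red-steps′ }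
    where
    open RedWalk w

    vertex′ : ℕ → Fin m
    vertex′ j with j ≤? k
    ... | yes _ = vertex j
    ... | no  _ = v

    ends-at′ : vertex′ (suc k) ≡ v
    ends-at′ with suc k ≤? k
    ... | yes k+1≤k = contradiction k+1≤k (ℕ.<-irrefl refl)
    ... | no  _     = refl

    visits′ : ∀ {j} → j ≤ suc k → vertex′ j ∈ A j
    visits′ {j} j≤k+1 with j ≤? k
    ... | yes j≤k = visits j≤k
    ... | no  j≰k rewrite ℕ.≤-antisym j≤k+1 (ℕ.≰⇒> j≰k) = v∈

    red-steps′ : ∀ {j} → j < suc k → c (vertex′ j) (vertex′ (suc j)) ≡ red
    red-steps′ {j} (s≤s j≤k) with j ≤? k | suc j ≤? k
    ... | no  j≰k | _         = contradiction j≤k j≰k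
    ... | yes _   | yes j+1≤k = red-steps j+1≤k
    ... | yes _   | no  j+1≰k rewrite ℕ.≤-antisym j≤k (ℕ.s≤s⁻¹ (ℕ.≰⇒> j+1≰k)) =
      subst (λ x → c x v ≡ red) (sym ends-at) red-uv

  reached⇒RedWalk : ∀ k {v} → v ∈ reached k → RedWalk k v
  reached⇒RedWalk zero {v} v∈ = record
    { vertex = λ _ → v ; ends-at = refl ; visits = λ { z≤n → v∈ } ; red-steps = λ () }
  reached⇒RedWalk (suc k) v∈ with x∈p∩q⁻ _ _ v∈
  ... | v∈A , v∈N with ∈-toSubset⁻ (redNeighbour? _) v∈N
  ...   | u , u∈ , red-uv = extend (reached⇒RedWalk k u∈) red-uv v∈A

module _ {m n : ℕ} (part : Fin m → Fin n) where

  layer : ℕ → Subset m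
  layer k = toSubset (λ v → toℕ (part v) ℕ.≟ k)

  cell≡layer : ∀ i → cell part i ≡ layer (toℕ i)
  cell≡layer i = tabulate-cong λ v → trans (isYes≗does (part v Fin.≟ i))
    (does-⇔ (mk⇔ (cong toℕ) toℕ-injective) (part v Fin.≟ i) (toℕ (part v) ℕ.≟ toℕ i))

  ∣layer∣≥ : ∀ {N k} → (∀ i → N ≤ ∣ cell part i ∣) → (i : Fin n) → toℕ i ≡ k → N ≤ ∣ layer k ∣
  ∣layer∣≥ ∣cell∣≥N i refl = subst (λ S → _ ≤ ∣ S ∣) (cell≡layer i) (∣cell∣≥N i)

  ∈layer⇒ : ∀ {k v} (i : Fin n) → toℕ i ≡ k → v ∈ layer k → part v ≡ i
  ∈layer⇒ i refl v∈ = toℕ-injective (∈-toSubset⁻ (λ v → toℕ (part v) ℕ.≟ toℕ i) v∈)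

module _ {m n : ℕ} (part : Fin m → Fin n) (c : Fin m → Fin m → Colour) where

  RedTransversal : Set
  RedTransversal = Σ (Fin n → Fin m) λ u → (∀ i → part (u i) ≡ i) ×
    (∀ (i j : Fin n) → toℕ j ≡ suc (toℕ i) → c (u i) (u j) ≡ red)

  BlueBiclique : ℕ → Set
  BlueBiclique N = Σ (Fin n) λ i → Σ (Fin n) λ j → toℕ j ≡ suc (toℕ i) ×
    (Σ (Subset m) λ B → Σ (Subset m) λ B′ → (∀ v → v ∈ B → part v ≡ i) × (∀ v → v ∈ B′ → part v ≡ j) ×
      N ≤ 2 * ∣ B ∣ × N ≤ 2 * ∣ B′ ∣ ×
      (∀ (u v : Fin m) → u ∈ B → v ∈ B′ → c u v ≡ blue))

module _ {m n : ℕ} (part : Fin m → Fin (suc n)) (c : Fin m → Fin m → Colour) where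
  open RedLayers c (layer part)

  redTransversal : Nonempty (reached n) → RedTransversal part c
  redTransversal (v , v∈) = vertex ∘ toℕ , on-layer , red-edge
    where
    open RedWalk (reached⇒RedWalk n v∈)

    on-layer : ∀ i → part (vertex (toℕ i)) ≡ i
    on-layer i = ∈layer⇒ part i refl (visits (toℕ≤pred[n] i))

    red-edge : ∀ i j → toℕ j ≡ suc (toℕ i) → c (vertex (toℕ i)) (vertex (toℕ j)) ≡ red
    red-edge i j tj rewrite tj = red-steps (subst (_≤ n) tj (toℕ≤pred[n] j))

  blueBiclique : ∀ {N} → 0 < N → (∀ i → N ≤ ∣ cell part i ∣) → ¬ Nonempty (reached n) →
                 BlueBiclique part c N
  blueBiclique {N} 0<N ∣cell∣≥N Rₙ-empty
    with downcrossing (λ k → 2 * ∣ reached k ∣) n N≤2∣R₀∣ 2∣Rₙ∣<N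
    where
    N≤2∣R₀∣ : N ≤ 2 * ∣ reached 0 ∣
    N≤2∣R₀∣ = ℕ.≤-trans (∣layer∣≥ part ∣cell∣≥N Fin.zero refl) (ℕ.m≤m+n _ _)

    2∣Rₙ∣<N : 2 * ∣ reached n ∣ < N
    2∣Rₙ∣<N rewrite Empty-unique Rₙ-empty | ∣⊥∣≡0 m = 0<N
  ... | k , k<n , N≤2∣Rₖ∣ , 2∣Rₖ₊₁∣<N =
    i , j , cong suc (sym (toℕ-inject₁ k′)) , reached k , unreached k ,
    (λ v v∈ → ∈layer⇒ part i toℕi≡k (reached⊆A k v∈)) ,
    (λ v v∈ → ∈layer⇒ part j toℕj≡k+1 (unreached⊆A k v∈)) ,
    N≤2∣Rₖ∣ , N≤2∣Uₖ∣ , (λ _ _ → reached→unreached-blue k)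
    where
    k′ : Fin n
    k′ = fromℕ< k<n

    i j : Fin (suc n)
    i = inject₁ k′
    j = Fin.suc k′

    toℕi≡k : toℕ i ≡ k
    toℕi≡k = trans (toℕ-inject₁ k′) (toℕ-fromℕ< k<n)

    toℕj≡k+1 : toℕ j ≡ suc k
    toℕj≡k+1 = cong suc (toℕ-fromℕ< k<n)

    N≤2∣Uₖ∣ : N ≤ 2 * ∣ unreached k ∣
    N≤2∣Uₖ∣ = half-of-rest {b = ∣ reached (suc k) ∣}
      (subst (N ≤_) (sym (∣reached∣+∣unreached∣≡∣A∣ k)) (∣layer∣≥ part ∣cell∣≥N j toℕj≡k+1))
      2∣Rₖ₊₁∣<N

lemma2p4 : (N n m : ℕ) → 0 < N → 0 < n → n * N ≤ m →
    (part : Fin m → Fin n) → (∀ i → N ≤ ∣ cell part i ∣) →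
    (c : Fin m → Fin m → Colour) → (∀ u v → c u v ≡ c v u) →
    (Σ (Fin n → Fin m) λ u → ((∀ i → part (u i) ≡ i) ×
             (∀ (i j : Fin n) → toℕ j ≡ suc (toℕ i) → c (u i) (u j) ≡ red)))
    ⊎
    (Σ (Fin n) λ i → Σ (Fin n) λ j → (toℕ j ≡ suc (toℕ i) ×
      (Σ (Subset m) λ B → Σ (Subset m) λ B′ → ((∀ v → v ∈ B → part v ≡ i) × (∀ v → v ∈ B′ → part v ≡ j) ×
        N ≤ 2 * ∣ B ∣ × N ≤ 2 * ∣ B′ ∣ ×
        (∀ (u v : Fin m) → u ∈ B → v ∈ B′ → c u v ≡ blue)))))
lemma2p4 N (suc n) m 0<N _ _ part ∣cell∣≥N c _ with nonempty? (RedLayers.reached c (layer part) n)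
... | yes Rₙ-nonempty = inj₁ (redTransversal part c Rₙ-nonempty)
... | no  Rₙ-empty    = inj₂ (blueBiclique part c 0<N ∣cell∣≥N Rₙ-empty)
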